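{- For a non-negative integer $\ell$ and a positive integer $k$, $$D(k,\ell)=\begin{cases}\infty & \text{if } \ell=0,\\ 2k-\ell-1 & \text{if } k\ge\ell\ge1,\\ k-1 & \text{if } \ell\ge k.\end{cases}$$
   Context: $[n]=\{1,\ldots,n\}$. For a set $S$ of integers $x_1<x_2<\cdots<x_r$, $OD(S)$ is the number of odd integers among the differences $x_2-x_1,x_3-x_2,\ldots,x_r-x_{r-1}$ (so $OD$ of a singleton is $0$). $D(k,\ell)$ is the largest integer $n$ such that every $k$-element subset of $[n]$ contains a subset $S$ with $OD(S)\ge\ell$ (with $D(k,\ell)=\infty$ if this holds for all $n$). -}

module Defs where

open import Data.Nat using (ℕ; zero; suc; _+_; _∸_; _%_; _≤_; _<_)
open import Data.List using (List; []; _∷_; length)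
open import Data.List.Relation.Unary.All using (All)
open import Data.List.Relation.Unary.Linked using (Linked)
open import Data.List.Relation.Binary.Sublist.Propositional using (_⊆_)
open import Data.Maybe using (Maybe; just; nothing)
open import Data.Product using (_×_; ∃-syntax)
open import Relation.Binary.PropositionalEquality using (_≡_)
open import Relation.Nullary using (¬_)

-- A finite set of integers x₁ < x₂ < ⋯ < x_r is represented by the
-- strictly increasing list [x₁, …, x_r].

OD : List ℕ → ℕ
OD []            = 0
OD (x ∷ [])      = 0
OD (x ∷ y ∷ xs)  = ((y ∸ x) % 2) + OD (y ∷ xs)

IsKSubsetOf : ℕ → ℕ → List ℕ → Set
IsKSubsetOf k n T = Linked _<_ T × All (λ x → 1 ≤ x × x ≤ n) T × length T ≡ k

-- Property(k, ℓ, n): every k-element subset T of [n] contains a subset S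
-- (a sublist of the sorted list T, i.e. exactly a subset of T) with OD(S) ≥ ℓ.
Prop : ℕ → ℕ → ℕ → Set
Prop k ℓ n = ∀ (T : List ℕ) → IsKSubsetOf k n T → ∃[ S ] (S ⊆ T × ℓ ≤ OD S)

-- "D(k, ℓ) = v", where v = nothing encodes ∞:
--   D = ∞  : Prop holds for all n;
--   D = d  : d is the largest n for which Prop holds.
DIs : ℕ → ℕ → Maybe ℕ → Set
DIs k ℓ nothing  = ∀ n → Prop k ℓ n
DIs k ℓ (just d) = Prop k ℓ d × (∀ n → d < n → ¬ Prop k ℓ n)

-- Write ℓ = a + 1 and k = a + b + 1.  In a k-set x₁ < ⋯ < x_k every even
-- gap is at least 2, so x_k − x₁ ≥ 2(k − 1) − OD; inside [n] this forces
-- OD ≥ 2k − 1 − n, and the k-set itself is a good S once n ≤ 2k − ℓ − 1.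
-- Conversely OD is bounded by the number of parity changes between
-- neighbours, which never grows when passing to a sublist (parity change
-- satisfies the triangle inequality).  The set
-- {1, …, a} ∪ {a+1, a+3, …, a+1+2b} has a parity changes and lies in
-- [a + 2b + 1], so none of its subsets reaches OD = a + 1.  For ℓ ≥ k
-- this set is [k], while [k − 1] has no k-subsets at all.
module Submission where

open import Defs
open import Data.Nat using (ℕ; zero; suc; _+_; _*_; _∸_; _≤_; _<_; _%_; z≤n; s≤s)
open import Data.Nat.Properties
open import Data.Nat.DivMod using ([m+kn]%n≡m%n; %-distribˡ-+; m%n≤m; m%n<n; m*n%n≡0)
open import Data.Nat.Tactic.RingSolver using (solve-∀)
open import Data.List using (List; []; _∷_; length)
open import Data.List.Relation.Unary.All as All using (All; []; _∷_)
open import Data.List.Relation.Unary.Linked using (Linked; [-]; _∷_; tail)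
open import Data.List.Relation.Binary.Sublist.Propositional using (_⊆_; []; _∷_; _∷ʳ_; ⊆-refl; minimum)
open import Data.Maybe using (just; nothing)
open import Data.Product using (_×_; _,_; proj₂)
open import Data.Sum using (inj₁; inj₂)
open import Data.Empty using (⊥-elim)
open import Relation.Binary.PropositionalEquality using (_≡_; refl; sym; cong; cong₂; subst; module ≡-Reasoning)
open import Relation.Nullary using (¬_)

parityChanges : List ℕ → ℕ
parityChanges (x ∷ y ∷ xs) = (x + y) % 2 + parityChanges (y ∷ xs)
parityChanges _            = 0

[x+z]%2≤[x+y]%2+[y+z]%2 : ∀ x y z → (x + z) % 2 ≤ (x + y) % 2 + (y + z) % 2
[x+z]%2≤[x+y]%2+[y+z]%2 x y z = begin
  (x + z) % 2                         ≡⟨ [m+kn]%n≡m%n (x + z) y 2 ⟨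
  (x + z + y * 2) % 2                 ≡⟨ cong (_% 2) (regroup x y z) ⟩
  ((x + y) + (y + z)) % 2             ≡⟨ %-distribˡ-+ (x + y) (y + z) 2 ⟩
  ((x + y) % 2 + (y + z) % 2) % 2     ≤⟨ m%n≤m _ 2 ⟩
  (x + y) % 2 + (y + z) % 2           ∎
  where
  open ≤-Reasoning
  regroup : ∀ x y z → x + z + y * 2 ≡ (x + y) + (y + z)
  regroup = solve-∀

[y∸x]%2≤[x+y]%2 : ∀ x y → (y ∸ x) % 2 ≤ (x + y) % 2
[y∸x]%2≤[x+y]%2 x y with ≤-total x y
... | inj₁ x≤y = ≤-reflexive (begin-equality
  (y ∸ x) % 2           ≡⟨ [m+kn]%n≡m%n (y ∸ x) x 2 ⟨
  (y ∸ x + x * 2) % 2   ≡⟨ cong (_% 2) (regroup (y ∸ x) x) ⟩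
  (x + (y ∸ x + x)) % 2 ≡⟨ cong (λ m → (x + m) % 2) (m∸n+n≡m x≤y) ⟩
  (x + y) % 2           ∎)
  where
  open ≤-Reasoning
  regroup : ∀ d x → d + x * 2 ≡ x + (d + x)
  regroup = solve-∀
... | inj₂ y≤x rewrite m≤n⇒m∸n≡0 y≤x = z≤n

OD≤parityChanges : ∀ xs → OD xs ≤ parityChanges xs
OD≤parityChanges []           = z≤n
OD≤parityChanges (x ∷ [])     = z≤n
OD≤parityChanges (x ∷ y ∷ xs) = +-mono-≤ ([y∸x]%2≤[x+y]%2 x y) (OD≤parityChanges (y ∷ xs))

parityChanges-∷ : ∀ x xs → parityChanges (x ∷ xs) ≤ suc (parityChanges xs)
parityChanges-∷ x []       = z≤n
parityChanges-∷ x (y ∷ xs) = +-monoˡ-≤ (parityChanges (y ∷ xs)) (≤-pred (m%n<n (x + y) 2))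

parityChanges-tail : ∀ x xs → parityChanges xs ≤ parityChanges (x ∷ xs)
parityChanges-tail x []       = z≤n
parityChanges-tail x (y ∷ xs) = m≤n+m (parityChanges (y ∷ xs)) ((x + y) % 2)

parityChanges-delete : ∀ x y xs → parityChanges (x ∷ xs) ≤ parityChanges (x ∷ y ∷ xs)
parityChanges-delete x y []       = z≤n
parityChanges-delete x y (z ∷ xs) = begin
  (x + z) % 2 + rest                   ≤⟨ +-monoˡ-≤ rest ([x+z]%2≤[x+y]%2+[y+z]%2 x y z) ⟩
  ((x + y) % 2 + (y + z) % 2) + rest   ≡⟨ +-assoc ((x + y) % 2) ((y + z) % 2) rest ⟩
  (x + y) % 2 + ((y + z) % 2 + rest)   ∎
  where
  open ≤-Reasoning
  rest = parityChanges (z ∷ xs)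

parityChanges-∷-mono : ∀ x {xs ys} → xs ⊆ ys → parityChanges (x ∷ xs) ≤ parityChanges (x ∷ ys)
parityChanges-∷-mono x                 []              = ≤-refl
parityChanges-∷-mono x {ys = _ ∷ ys}   (y ∷ʳ xs⊆ys)    =
  ≤-trans (parityChanges-∷-mono x xs⊆ys) (parityChanges-delete x y ys)
parityChanges-∷-mono x {xs = y ∷ _}    (refl ∷ xs⊆ys)  =
  +-monoʳ-≤ ((x + y) % 2) (parityChanges-∷-mono y xs⊆ys)

parityChanges-mono : ∀ {xs ys} → xs ⊆ ys → parityChanges xs ≤ parityChanges ys
parityChanges-mono                 []              = ≤-refl
parityChanges-mono {ys = _ ∷ ys}   (y ∷ʳ xs⊆ys)    =
  ≤-trans (parityChanges-mono xs⊆ys) (parityChanges-tail y ys)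
parityChanges-mono {xs = x ∷ _}    (refl ∷ xs⊆ys)  = parityChanges-∷-mono x xs⊆ys

staircase : ℕ → ℕ → ℕ → List ℕ
staircase s (suc a) b       = s ∷ staircase (suc s) a b
staircase s zero    zero    = s ∷ []
staircase s zero    (suc b) = s ∷ staircase (2 + s) zero b

length-staircase : ∀ s a b → length (staircase s a b) ≡ suc (a + b)
length-staircase s (suc a) b       = cong suc (length-staircase (suc s) a b)
length-staircase s zero    zero    = refl
length-staircase s zero    (suc b) = cong suc (length-staircase (2 + s) zero b)

staircase-linked : ∀ {r} s a b → r < s → Linked _<_ (r ∷ staircase s a b)
staircase-linked s (suc a) b       r<s = r<s ∷ staircase-linked (suc s) a b (n<1+n s)
staircase-linked s zero    zero    r<s = r<s ∷ [-]
staircase-linked s zero    (suc b) r<s = r<s ∷ staircase-linked (2 + s) zero b (m<n+m s (s≤s z≤n))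

staircase-bounded : ∀ {m n} s a b → m ≤ s → s + (a + 2 * b) ≤ n →
                    All (λ x → m ≤ x × x ≤ n) (staircase s a b)
staircase-bounded s (suc a) b m≤s s+a+2b≤n =
  (m≤s , m+n≤o⇒m≤o s s+a+2b≤n) ∷
  staircase-bounded (suc s) a b (m≤n⇒m≤1+n m≤s)
    (≤-trans (≤-reflexive (sym (+-suc s (a + 2 * b)))) s+a+2b≤n)
staircase-bounded s zero zero m≤s s+0≤n = (m≤s , m+n≤o⇒m≤o s s+0≤n) ∷ []
staircase-bounded s zero (suc b) m≤s s+2b≤n =
  (m≤s , m+n≤o⇒m≤o s s+2b≤n) ∷
  staircase-bounded (2 + s) zero b (≤-trans m≤s (m≤n+m s 2))
    (≤-trans (≤-reflexive (regroup s b)) s+2b≤n)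
  where
  regroup : ∀ s b → 2 + s + 2 * b ≡ s + 2 * suc b
  regroup = solve-∀

[x+[2+x]]%2≡0 : ∀ x → (x + (2 + x)) % 2 ≡ 0
[x+[2+x]]%2≡0 x = subst (λ m → m % 2 ≡ 0) (regroup x) (m*n%n≡0 (suc x) 2)
  where
  regroup : ∀ x → suc x * 2 ≡ x + (2 + x)
  regroup = solve-∀

parityChanges-stride : ∀ s b → parityChanges (staircase s zero b) ≡ 0
parityChanges-stride s zero          = refl
parityChanges-stride s (suc zero)    = cong (_+ 0) ([x+[2+x]]%2≡0 s)
parityChanges-stride s (suc (suc b)) =
  cong₂ _+_ ([x+[2+x]]%2≡0 s) (parityChanges-stride (2 + s) (suc b))

parityChanges-staircase : ∀ s a b → parityChanges (staircase s a b) ≤ a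
parityChanges-staircase s (suc a) b =
  ≤-trans (parityChanges-∷ s (staircase (suc s) a b)) (s≤s (parityChanges-staircase (suc s) a b))
parityChanges-staircase s zero b    = ≤-reflexive (parityChanges-stride s b)

staircase-isKSubset : ∀ {n} a b → a + 2 * b < n → IsKSubsetOf (suc (a + b)) n (staircase 1 a b)
staircase-isKSubset a b a+2b<n =
  tail (staircase-linked 1 a b (s≤s z≤n)) , staircase-bounded 1 a b ≤-refl a+2b<n , length-staircase 1 a b

staircase⇒¬Prop : ∀ {k ℓ n} a b → a + b ≡ k → a < ℓ → a + 2 * b < n → ¬ Prop (suc k) ℓ n
staircase⇒¬Prop {ℓ = ℓ} a b refl a<ℓ a+2b<n P
  with S , S⊆T , ℓ≤OD ← P (staircase 1 a b) (staircase-isKSubset a b a+2b<n) = <⇒≱ a<ℓ (begin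
    ℓ                                ≤⟨ ℓ≤OD ⟩
    OD S                             ≤⟨ OD≤parityChanges S ⟩
    parityChanges S                  ≤⟨ parityChanges-mono S⊆T ⟩
    parityChanges (staircase 1 a b)  ≤⟨ parityChanges-staircase 1 a b ⟩
    a                                ∎)
  where open ≤-Reasoning

x<y⇒2+x≤y+[y∸x]%2 : ∀ {x y} → x < y → 2 + x ≤ y + (y ∸ x) % 2
x<y⇒2+x≤y+[y∸x]%2 {zero}  {suc zero}    _         = ≤-refl
x<y⇒2+x≤y+[y∸x]%2 {zero}  {suc (suc y)} _         = s≤s (s≤s z≤n)
x<y⇒2+x≤y+[y∸x]%2 {suc x} {suc y}       (s≤s x<y) = s≤s (x<y⇒2+x≤y+[y∸x]%2 x<y)

linked-OD-bound : ∀ {n x xs} → Linked _<_ (x ∷ xs) → All (_≤ n) (x ∷ xs) →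
                  x + 2 * length xs ≤ n + OD (x ∷ xs)
linked-OD-bound {xs = []} _ (x≤n ∷ []) = +-monoˡ-≤ 0 x≤n
linked-OD-bound {n} {x} {y ∷ ys} (x<y ∷ linked) (_ ∷ bounded) = begin
  x + 2 * suc L             ≡⟨ regroup₁ x L ⟩
  (2 + x) + 2 * L           ≤⟨ +-monoˡ-≤ (2 * L) (x<y⇒2+x≤y+[y∸x]%2 x<y) ⟩
  (y + d) + 2 * L           ≡⟨ regroup₂ y d L ⟩
  (y + 2 * L) + d           ≤⟨ +-monoˡ-≤ d (linked-OD-bound linked bounded) ⟩
  (n + OD (y ∷ ys)) + d     ≡⟨ regroup₃ n (OD (y ∷ ys)) d ⟩
  n + (d + OD (y ∷ ys))     ∎
  where
  open ≤-Reasoning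
  L = length ys
  d = (y ∸ x) % 2
  regroup₁ : ∀ x L → x + 2 * suc L ≡ (2 + x) + 2 * L
  regroup₁ = solve-∀
  regroup₂ : ∀ y d L → (y + d) + 2 * L ≡ (y + 2 * L) + d
  regroup₂ = solve-∀
  regroup₃ : ∀ n o d → (n + o) + d ≡ n + (d + o)
  regroup₃ = solve-∀

OD-lower-bound : ∀ {k n T} → IsKSubsetOf (suc k) n T → suc (2 * k) ≤ n + OD T
OD-lower-bound {T = x ∷ xs} (linked , bounded@((1≤x , _) ∷ _) , refl) =
  ≤-trans (+-monoˡ-≤ (2 * length xs) 1≤x) (linked-OD-bound linked (All.map proj₂ bounded))

n+ℓ≤1+2k⇒Prop : ∀ {k ℓ n} → n + ℓ ≤ suc (2 * k) → Prop (suc k) ℓ n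
n+ℓ≤1+2k⇒Prop {n = n} n+ℓ≤1+2k T T-sub =
  T , ⊆-refl , +-cancelˡ-≤ n _ _ (≤-trans n+ℓ≤1+2k (OD-lower-bound T-sub))

linked-length-bound : ∀ {n x xs} → Linked _<_ (x ∷ xs) → All (_≤ n) (x ∷ xs) → x + length xs ≤ n
linked-length-bound {x = x} {[]} _ (x≤n ∷ []) = ≤-trans (≤-reflexive (+-identityʳ x)) x≤n
linked-length-bound {x = x} {y ∷ ys} (x<y ∷ linked) (_ ∷ bounded) =
  ≤-trans (≤-reflexive (+-suc x (length ys)))
          (≤-trans (+-monoˡ-≤ (length ys) x<y) (linked-length-bound linked bounded))

kSubset⇒k≤n : ∀ {k n T} → IsKSubsetOf k n T → k ≤ n
kSubset⇒k≤n {T = []}     (_ , _ , refl) = z≤n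
kSubset⇒k≤n {T = x ∷ xs} (linked , bounded@((1≤x , _) ∷ _) , refl) =
  ≤-trans (+-monoˡ-≤ (length xs) 1≤x) (linked-length-bound linked (All.map proj₂ bounded))

n<k⇒Prop : ∀ {k ℓ n} → n < k → Prop k ℓ n
n<k⇒Prop n<k T T-sub = ⊥-elim (<⇒≱ n<k (kSubset⇒k≤n T-sub))

2*[1+a+b]∸[1+a]∸1≡a+2*b : ∀ a b → 2 * suc (a + b) ∸ suc a ∸ 1 ≡ a + 2 * b
2*[1+a+b]∸[1+a]∸1≡a+2*b a b = begin
  2 * suc (a + b) ∸ suc a ∸ 1         ≡⟨ cong (λ m → m ∸ suc a ∸ 1) (regroup a b) ⟩
  suc a + suc (a + 2 * b) ∸ suc a ∸ 1 ≡⟨ cong (_∸ 1) (m+n∸m≡n (suc a) _) ⟩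
  a + 2 * b                           ∎
  where
  open ≡-Reasoning
  regroup : ∀ a b → 2 * suc (a + b) ≡ suc a + suc (a + 2 * b)
  regroup = solve-∀

DIs-between : ∀ {k a} → a ≤ k → DIs (suc k) (suc a) (just (2 * suc k ∸ suc a ∸ 1))
DIs-between {a = a} a≤k with b , refl ← m≤n⇒∃[o]m+o≡n a≤k
  rewrite 2*[1+a+b]∸[1+a]∸1≡a+2*b a b =
  n+ℓ≤1+2k⇒Prop (≤-reflexive (regroup a b)) , λ n → staircase⇒¬Prop a b refl ≤-refl
  where
  regroup : ∀ a b → a + 2 * b + suc a ≡ suc (2 * (a + b))
  regroup = solve-∀

DIs-beyond : ∀ {k ℓ} → k < ℓ → DIs (suc k) ℓ (just k)
DIs-beyond {k} k<ℓ = n<k⇒Prop ≤-refl , λ n k<n →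
  staircase⇒¬Prop k 0 (+-identityʳ k) k<ℓ (subst (_< n) (sym (+-identityʳ k)) k<n)

proposition3 : (k ℓ : ℕ) → 1 ≤ k →
    (ℓ ≡ 0 → DIs k ℓ nothing)
    × (1 ≤ ℓ → ℓ ≤ k → DIs k ℓ (just (2 * k ∸ ℓ ∸ 1)))
    × (k ≤ ℓ → DIs k ℓ (just (k ∸ 1)))
proposition3 (suc k) ℓ _ = unbounded , between , DIs-beyond
  where
  unbounded : ℓ ≡ 0 → DIs (suc k) ℓ nothing
  unbounded refl n T _ = [] , minimum T , z≤n
  between : 1 ≤ ℓ → ℓ ≤ suc k → DIs (suc k) ℓ (just (2 * suc k ∸ ℓ ∸ 1))
  between (s≤s z≤n) (s≤s a≤k) = DIs-between a≤k
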